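{- Let $G$ be a finite group, $H\le G$, and $A\subseteq G$ a union of $H$-double cosets with $A=A^{ -1}$, and let $\Gamma:=\mathrm{Cos}(G,H,A)$. Let $B$ be a subset of $A$. If every $\varphi\in\mathrm{Aut}(\Gamma)_H$ fixes the set $\{Hx\mid x\in B\}$ pointwise, then every $\varphi\in\mathrm{Aut}(\Gamma)_H$ fixes the set $\{Hx\mid x\in\langle B\rangle\}$ pointwise.
   Context: The coset graph $\mathrm{Cos}(G,H,A)$ has as vertices the right cosets of $H$ in $G$, with $(Hx,Hy)$ an arc iff $Hyx^{ -1}H\subseteq HAH$; when $A=A^{ -1}$ this relation is symmetric, so it is a graph, and $G$ acts on it vertex-transitively by right multiplication. $\mathrm{Aut}(\Gamma)_H$ denotes the stabilizer in $\mathrm{Aut}(\Gamma)$ of the vertex $H$. -}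

module Defs where

open import Level using (Level; _⊔_)
open import Algebra.Bundles using (Group)
open import Data.Product using (Σ; ∃; _×_; _,_)
open import Data.List using (List)
open import Data.List.Relation.Unary.Any using (Any)
open import Relation.Unary using (Pred)

module CosetGraph {c ℓ : Level} (G : Group c ℓ) where
  open Group G

  IsFinite : Set (c ⊔ ℓ)
  IsFinite = Σ (List Carrier) λ xs → ∀ x → Any (λ y → x ≈ y) xs

  RespectsEq : ∀ {p} → Pred Carrier p → Set (c ⊔ ℓ ⊔ p)
  RespectsEq P = ∀ {x y} → x ≈ y → P x → P y

  record IsSubgroup {p} (H : Pred Carrier p) : Set (c ⊔ ℓ ⊔ p) where
    field
      resp  : RespectsEq H
      ε∈    : H ε
      ∙-closed : ∀ {x y} → H x → H y → H (x ∙ y)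
      ⁻¹-closed : ∀ {x} → H x → H (x ⁻¹)

  UnionOfDoubleCosets : ∀ {p q} → Pred Carrier p → Pred Carrier q → Set (c ⊔ p ⊔ q)
  UnionOfDoubleCosets H A = ∀ {h a k} → H h → A a → H k → A ((h ∙ a) ∙ k)

  InverseClosed : ∀ {q} → Pred Carrier q → Set (c ⊔ q)
  InverseClosed A = ∀ {a} → A a → A (a ⁻¹)

  -- Right cosets: Hx = Hy  iff  x y⁻¹ ∈ H.  A vertex Hx of Cos(G,H,A) is
  -- represented by any representative x; _∼_ is equality of vertices.
  SameCoset : ∀ {p} → Pred Carrier p → Carrier → Carrier → Set p
  SameCoset H x y = H (x ∙ y ⁻¹)

  InHAH : ∀ {p q} → Pred Carrier p → Pred Carrier q → Carrier → Set (c ⊔ ℓ ⊔ p ⊔ q)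
  InHAH H A z = ∃ λ h → ∃ λ a → ∃ λ k → H h × A a × H k × (z ≈ (h ∙ a) ∙ k)

  Adj : ∀ {p q} → Pred Carrier p → Pred Carrier q → Carrier → Carrier → Set (c ⊔ ℓ ⊔ p ⊔ q)
  Adj H A x y = ∀ {h k} → H h → H k → InHAH H A ((h ∙ (y ∙ x ⁻¹)) ∙ k)

  -- φ ∈ Aut(Cos(G,H,A)), given as a map on representatives that is
  -- well defined on cosets, bijective on cosets, and preserves arcs and non-arcs.
  record IsAut {p q} (H : Pred Carrier p) (A : Pred Carrier q)
               (φ : Carrier → Carrier) : Set (c ⊔ ℓ ⊔ p ⊔ q) where
    field
      well-defined : ∀ {x y} → SameCoset H x y → SameCoset H (φ x) (φ y)
      injective    : ∀ {x y} → SameCoset H (φ x) (φ y) → SameCoset H x y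
      surjective   : ∀ y → ∃ λ x → SameCoset H (φ x) y
      adj-pres     : ∀ {x y} → Adj H A x y → Adj H A (φ x) (φ y)
      adj-refl     : ∀ {x y} → Adj H A (φ x) (φ y) → Adj H A x y

  IsAutStab : ∀ {p q} → Pred Carrier p → Pred Carrier q → (Carrier → Carrier) → Set (c ⊔ ℓ ⊔ p ⊔ q)
  IsAutStab H A φ = IsAut H A φ × SameCoset H (φ ε) ε

  FixesPointwise : ∀ {p r} → Pred Carrier p → Pred Carrier r → (Carrier → Carrier) → Set (c ⊔ p ⊔ r)
  FixesPointwise H S φ = ∀ {x} → S x → SameCoset H (φ x) x

  data ⟨_⟩ {r} (B : Pred Carrier r) : Carrier → Set (c ⊔ ℓ ⊔ r) where
    gen : ∀ {x} → B x → ⟨ B ⟩ x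
    one : ⟨ B ⟩ ε
    mul : ∀ {x y} → ⟨ B ⟩ x → ⟨ B ⟩ y → ⟨ B ⟩ (x ∙ y)
    inv : ∀ {x} → ⟨ B ⟩ x → ⟨ B ⟩ (x ⁻¹)
    resp : ∀ {x y} → x ≈ y → ⟨ B ⟩ x → ⟨ B ⟩ y

module Submission where

-- Let Fix be the set of g ∈ G such that every φ ∈ Aut(Γ)_H fixes the
-- vertex Hg.  The theorem says Fix ⊇ ⟨B⟩ once Fix ⊇ B, so it suffices to
-- show that Fix is a subgroup of G.
--
--  * Right multiplication ρ_y : Hz ↦ Hzy is an automorphism of Γ, since
--    both cosets and arcs depend only on quotients z w⁻¹, which ρ_y keeps.
--    Hence if φ ∈ Aut(Γ) fixes Hy, then ρ_y⁻¹ ∘ φ ∘ ρ_y lies in Aut(Γ)_H.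
--  * Fix contains ε and is closed under products: for x, y ∈ Fix and
--    φ ∈ Aut(Γ)_H, the conjugate ρ_y⁻¹ φ ρ_y fixes Hx, i.e. φ fixes Hxy.
--  * In a finite group every inverse g⁻¹ is a power gⁿ (pigeonhole on the
--    powers of g), so the submonoid Fix is closed under inverses too.

open import Defs
open import Level using (Level)
open import Algebra.Bundles using (Group)
open import Relation.Unary using (Pred; _⊆_)
open import Data.Product using (∃; ∃₂; _,_)
open import Data.Nat as ℕ using (ℕ; suc)
open import Data.Nat.Properties using (n<1+n; +-suc; m≤n⇒∃[o]m+o≡n)
open import Data.Fin using (toℕ)
open import Data.Fin.Properties using (pigeonhole)
open import Data.List using (length; lookup)
open import Data.List.Relation.Unary.Any using (index)
open import Data.List.Relation.Unary.Any.Properties using (lookup-index)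
import Relation.Binary.PropositionalEquality as ≡
import Algebra.Properties.Group as GroupProperties
import Algebra.Properties.Monoid.Mult as MonoidPowers
import Relation.Binary.Reasoning.Setoid as SetoidReasoning

module FiniteGroup {c ℓ : Level} (G : Group c ℓ) where
  open Group G
  open CosetGraph G using (IsFinite)
  open GroupProperties G using (∙-cancelˡ; inverseʳ-unique)
  open MonoidPowers monoid using (×-homo-+) renaming (_×_ to _times_)

  infixr 8 _^_
  _^_ : Carrier → ℕ → Carrier
  g ^ n = n times g

  ^-homo-+ : ∀ g m n → g ^ (m ℕ.+ n) ≈ g ^ m ∙ g ^ n
  ^-homo-+ g = ×-homo-+ g

  -- Pigeonhole: among the |G|+1 powers g⁰, …, g^|G| two coincide.
  powers-collide : IsFinite → ∀ g → ∃₂ λ i k → g ^ i ≈ g ^ (i ℕ.+ suc k)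
  powers-collide (xs , enum) g
    with pigeonhole (n<1+n (length xs)) (λ n → index (enum (g ^ toℕ n)))
  ... | i , j , i<j , same-index with m≤n⇒∃[o]m+o≡n i<j
  ... | k , i+1+k≡j = toℕ i , k , (begin
    g ^ toℕ i                            ≈⟨ lookup-index (enum (g ^ toℕ i)) ⟩
    lookup xs (index (enum (g ^ toℕ i))) ≡⟨ ≡.cong (lookup xs) same-index ⟩
    lookup xs (index (enum (g ^ toℕ j))) ≈⟨ lookup-index (enum (g ^ toℕ j)) ⟨
    g ^ toℕ j                            ≡⟨ ≡.cong (g ^_) i+k+1≡j ⟨
    g ^ (toℕ i ℕ.+ suc k)                ∎)
    where
    open SetoidReasoning setoid
    i+k+1≡j : toℕ i ℕ.+ suc k ≡.≡ toℕ j
    i+k+1≡j = ≡.trans (+-suc (toℕ i) k) i+1+k≡j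

  -- Cancelling gⁱ from gⁱ = gⁱ ∙ g ∙ gᵏ gives g ∙ gᵏ = ε, so g⁻¹ = gᵏ.
  inverse-is-power : IsFinite → ∀ g → ∃ λ n → g ^ n ≈ g ⁻¹
  inverse-is-power fin g with powers-collide fin g
  ... | i , k , collision =
    k , inverseʳ-unique g (g ^ k) (sym (∙-cancelˡ (g ^ i) ε (g ∙ g ^ k) (begin
      g ^ i ∙ ε                ≈⟨ identityʳ (g ^ i) ⟩
      g ^ i                    ≈⟨ collision ⟩
      g ^ (i ℕ.+ suc k)        ≈⟨ ^-homo-+ g i (suc k) ⟩
      g ^ i ∙ (g ∙ g ^ k)      ∎)))
    where open SetoidReasoning setoid

module Stabiliser {c ℓ p q : Level} (G : Group c ℓ)
  (H : Pred (Group.Carrier G) p) (H-subgroup : CosetGraph.IsSubgroup G H)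
  (A : Pred (Group.Carrier G) q) where
  open Group G
  open CosetGraph G
  open IsSubgroup H-subgroup using (ε∈; ∙-closed) renaming (resp to H-resp)
  open GroupProperties G
    using (x≈y⇒x∙y⁻¹≈ε; ⁻¹-anti-homo-∙; \\-leftDividesʳ; //-rightDividesˡ; //-rightDividesʳ)
  open FiniteGroup G using (_^_; inverse-is-power)
  open SetoidReasoning setoid

  _∼_ : Carrier → Carrier → Set p
  _∼_ = SameCoset H

  ≈⇒∼ : ∀ {x y} → x ≈ y → x ∼ y
  ≈⇒∼ x≈y = H-resp (sym (x≈y⇒x∙y⁻¹≈ε x≈y)) ε∈

  ∼-trans : ∀ {x y z} → x ∼ y → y ∼ z → x ∼ z
  ∼-trans {x} {y} {z} x∼y y∼z = H-resp telescope (∙-closed x∼y y∼z)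
    where
    telescope : (x ∙ y ⁻¹) ∙ (y ∙ z ⁻¹) ≈ x ∙ z ⁻¹
    telescope = begin
      (x ∙ y ⁻¹) ∙ (y ∙ z ⁻¹) ≈⟨ assoc x (y ⁻¹) (y ∙ z ⁻¹) ⟩
      x ∙ (y ⁻¹ ∙ (y ∙ z ⁻¹)) ≈⟨ ∙-congˡ (\\-leftDividesʳ y (z ⁻¹)) ⟩
      x ∙ z ⁻¹                ∎

  -- Right translation by g does not change quotients x y⁻¹.  Both cosets
  -- and arcs of Γ are defined through such quotients, so ρ_g ∈ Aut(Γ).
  translation-keeps-quotient : ∀ x y g → (x ∙ g) ∙ (y ∙ g) ⁻¹ ≈ x ∙ y ⁻¹
  translation-keeps-quotient x y g = begin
    (x ∙ g) ∙ (y ∙ g) ⁻¹     ≈⟨ ∙-congˡ (⁻¹-anti-homo-∙ y g) ⟩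
    (x ∙ g) ∙ (g ⁻¹ ∙ y ⁻¹)  ≈⟨ assoc x g (g ⁻¹ ∙ y ⁻¹) ⟩
    x ∙ (g ∙ (g ⁻¹ ∙ y ⁻¹))  ≈⟨ ∙-congˡ (assoc g (g ⁻¹) (y ⁻¹)) ⟨
    x ∙ ((g ∙ g ⁻¹) ∙ y ⁻¹)  ≈⟨ ∙-congˡ (∙-congʳ (inverseʳ g)) ⟩
    x ∙ (ε ∙ y ⁻¹)           ≈⟨ ∙-congˡ (identityˡ (y ⁻¹)) ⟩
    x ∙ y ⁻¹                 ∎

  ∼-translate : ∀ {x y} g → x ∼ y → (x ∙ g) ∼ (y ∙ g)
  ∼-translate {x} {y} g = H-resp (sym (translation-keeps-quotient x y g))

  ∼-untranslate : ∀ {x y} g → (x ∙ g) ∼ (y ∙ g) → x ∼ y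
  ∼-untranslate {x} {y} g = H-resp (translation-keeps-quotient x y g)

  Adj-by-quotient : ∀ {x y x′ y′} → y ∙ x ⁻¹ ≈ y′ ∙ x′ ⁻¹ →
                    Adj H A x y → Adj H A x′ y′
  Adj-by-quotient same-quotient adj h∈H k∈H with adj h∈H k∈H
  ... | h′ , a , k′ , h′∈H , a∈A , k′∈H , eq =
    h′ , a , k′ , h′∈H , a∈A , k′∈H ,
    trans (∙-congʳ (∙-congˡ (sym same-quotient))) eq

  Adj-translate : ∀ {x y} g → Adj H A x y → Adj H A (x ∙ g) (y ∙ g)
  Adj-translate {x} {y} g = Adj-by-quotient (sym (translation-keeps-quotient y x g))

  Adj-untranslate : ∀ {x y} g → Adj H A (x ∙ g) (y ∙ g) → Adj H A x y
  Adj-untranslate {x} {y} g = Adj-by-quotient (translation-keeps-quotient y x g)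

  conjugate : (Carrier → Carrier) → Carrier → Carrier → Carrier
  conjugate φ y z = φ (z ∙ y) ∙ y ⁻¹

  conjugate-isAut : ∀ {φ} y → IsAut H A φ → IsAut H A (conjugate φ y)
  conjugate-isAut {φ} y φ-aut = record
    { well-defined = λ x∼x′ → ∼-translate (y ⁻¹) (well-defined (∼-translate y x∼x′))
    ; injective    = λ φx∼φx′ → ∼-untranslate y (injective (∼-untranslate (y ⁻¹) φx∼φx′))
    ; surjective   = preimage
    ; adj-pres     = λ adj → Adj-translate (y ⁻¹) (adj-pres (Adj-translate y adj))
    ; adj-refl     = λ adj → Adj-untranslate y (adj-refl (Adj-untranslate (y ⁻¹) adj))
    }
    where
    open IsAut φ-aut
    -- if φ(Hx) = Hty then the conjugate maps H(x y⁻¹) to Ht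
    preimage : ∀ t → ∃ λ z → conjugate φ y z ∼ t
    preimage t with surjective (t ∙ y)
    ... | x , φx∼ty = x ∙ y ⁻¹ , ∼-trans
      (∼-translate (y ⁻¹) (∼-trans (well-defined (≈⇒∼ (//-rightDividesˡ y x))) φx∼ty))
      (≈⇒∼ (//-rightDividesʳ y t))

  conjugate-fixes-base : ∀ {φ} y → IsAut H A φ → φ y ∼ y → conjugate φ y ε ∼ ε
  conjugate-fixes-base {φ} y φ-aut φy∼y =
    ∼-trans (∼-translate (y ⁻¹) (∼-trans (IsAut.well-defined φ-aut (≈⇒∼ (identityˡ y))) φy∼y))
            (≈⇒∼ (inverseʳ y))

  conjugate-isAutStab : ∀ {φ} y → IsAut H A φ → φ y ∼ y → IsAutStab H A (conjugate φ y)
  conjugate-isAutStab y φ-aut φy∼y =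
    conjugate-isAut y φ-aut , conjugate-fixes-base y φ-aut φy∼y

  Fix : Carrier → Set _
  Fix g = ∀ φ → IsAutStab H A φ → φ g ∼ g

  Fix-ε : Fix ε
  Fix-ε φ (_ , φε∼ε) = φε∼ε

  Fix-resp : ∀ {x y} → x ≈ y → Fix x → Fix y
  Fix-resp x≈y fix-x φ (φ-aut , φε∼ε) =
    ∼-trans (IsAut.well-defined φ-aut (≈⇒∼ (sym x≈y)))
            (∼-trans (fix-x φ (φ-aut , φε∼ε)) (≈⇒∼ x≈y))

  -- φ fixes Hy, so its conjugate by ρ_y lies in Aut(Γ)_H and fixes Hx;
  -- unfolding, φ(xy) y⁻¹ ∼ x, i.e. φ fixes Hxy.
  Fix-∙ : ∀ {x y} → Fix x → Fix y → Fix (x ∙ y)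
  Fix-∙ {x} {y} fix-x fix-y φ φ-stab@(φ-aut , _) =
    ∼-untranslate (y ⁻¹) (∼-trans
      (fix-x (conjugate φ y) (conjugate-isAutStab y φ-aut (fix-y φ φ-stab)))
      (≈⇒∼ (sym (//-rightDividesʳ y x))))

  Fix-power : ∀ {g} n → Fix g → Fix (g ^ n)
  Fix-power 0       _     = Fix-ε
  Fix-power (suc n) fix-g = Fix-∙ fix-g (Fix-power n fix-g)

  Fix-⁻¹ : IsFinite → ∀ {g} → Fix g → Fix (g ⁻¹)
  Fix-⁻¹ fin {g} fix-g with inverse-is-power fin g
  ... | n , gⁿ≈g⁻¹ = Fix-resp gⁿ≈g⁻¹ (Fix-power n fix-g)

  Fix-⟨⟩ : ∀ {r} {B : Pred Carrier r} → IsFinite → B ⊆ Fix → ⟨ B ⟩ ⊆ Fix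
  Fix-⟨⟩ fin B⊆Fix (gen b)     = B⊆Fix b
  Fix-⟨⟩ fin B⊆Fix one         = Fix-ε
  Fix-⟨⟩ fin B⊆Fix (mul x y)   = Fix-∙ (Fix-⟨⟩ fin B⊆Fix x) (Fix-⟨⟩ fin B⊆Fix y)
  Fix-⟨⟩ fin B⊆Fix (inv x)     = Fix-⁻¹ fin (Fix-⟨⟩ fin B⊆Fix x)
  Fix-⟨⟩ fin B⊆Fix (resp eq x) = Fix-resp eq (Fix-⟨⟩ fin B⊆Fix x)

lemma3p5 : ∀ {c ℓ p q r : Level} (G : Group c ℓ) → CosetGraph.IsFinite G
    → (H : Pred (Group.Carrier G) p) → CosetGraph.IsSubgroup G H
    → (A : Pred (Group.Carrier G) q) → CosetGraph.RespectsEq G A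
    → CosetGraph.UnionOfDoubleCosets G H A → CosetGraph.InverseClosed G A
    → (B : Pred (Group.Carrier G) r) → CosetGraph.RespectsEq G B → B ⊆ A
    → (∀ φ → CosetGraph.IsAutStab G H A φ → CosetGraph.FixesPointwise G H B φ)
    → (∀ φ → CosetGraph.IsAutStab G H A φ → CosetGraph.FixesPointwise G H (CosetGraph.⟨_⟩ G B) φ)
lemma3p5 G fin H H-subgroup A _ _ _ B _ _ B-fixed φ φ-stab x∈⟨B⟩ =
  Stabiliser.Fix-⟨⟩ G H H-subgroup A fin (λ b ψ ψ-stab → B-fixed ψ ψ-stab b) x∈⟨B⟩ φ φ-stab
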